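{- Let $n\ge 1$ and let $S=(S[1],\dots,S[n])$ be a strategy of length $n$ in which $S[k]$ is a derangement of $[k]$ for every $2\le k\le n$. Then $[x^1]f_S(x)=1$ and $[x^2]f_S(x)=A(n,1)=2^n-n-1$; that is, exactly one permutation of $[n]$ is guessed in exactly one guess and exactly $2^n-n-1$ permutations of $[n]$ are guessed in exactly two guesses.
   Context: Permutation wordle on $[n]=\{1,\dots,n\}$: a secret permutation $\pi\in S_n$ (one-line notation) is fixed. The guesser's first guess is $\gamma_1=[1,2,\dots,n]$. After guess $\gamma_r$ the guesser learns $\mathcal{J}_r=\{i\in[n]:\gamma_r(i)=\pi(i)\}$; let $\mathcal{I}_r=[n]\setminus\mathcal{J}_r$. The game ends at the first $r$ with $\mathcal{J}_r=[n]$, and $r$ is then the number of guesses. A strategy of length $n$ is a sequence $S=(S[1],\dots,S[n])$ where $S[k]$ is a permutation of $[k]$. If the game has not ended, write $\mathcal{I}_r=\{i_1<\dots<i_k\}$ and $\sigma=S[k]$; the next guess is $\gamma_{r+1}(i)=\gamma_r(i)$ for $i\in\mathcal{J}_r$ and $\gamma_{r+1}(i_{\sigma(j)})=\gamma_r(i_j)$ for $j=1,\dots,k$. The generating function is $f_S(x)=\sum_{r\ge1}a_rx^r$, where $a_r$ is the number of $\pi\in S_n$ for which the game played with $S$ ends after exactly $r$ guesses. $A(n,1)$ is the Eulerian number (number of permutations of $[n]$ with exactly one descent), equal to $2^n-n-1$. -}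

module Defs where

open import Data.Nat using (ℕ; zero; suc; _≤_; _<_; _^_; _∸_; _≤?_; _+_) renaming (_≟_ to _≟ℕ_)
open import Data.Nat.Properties using (≤-reflexive; ≤-trans)
open import Data.Fin using (Fin; _≟_; toℕ; _<?_)
open import Data.Fin.Properties using (all?)
open import Data.Fin.Permutation using (Permutation′; _⟨$⟩ʳ_)
open import Data.List as List using (List; []; _∷_; length; filter; allFin)
open import Data.List.Properties using (length-filter; length-tabulate)
open import Data.List.Relation.Unary.Unique.Propositional using (Unique)
open import Data.List.Relation.Unary.AllPairs using (allPairs?)
open import Data.Vec as Vec using (Vec; lookup; _[_]≔_; fromList; toList)
open import Data.Vec.Properties using (≡-dec)
open import Data.Product using (_×_; _,_)
open import Relation.Nullary using (¬_; ¬?)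
open import Relation.Nullary.Decidable using (isYes)
open import Data.Bool using (if_then_else_)
open import Relation.Nullary.Decidable using (_×-dec_)
open import Relation.Binary.PropositionalEquality using (_≡_; _≢_)
open import Relation.Unary using (Decidable)

-- Permutations of [n] in one-line notation.
-- [n] = {1,…,n} is modelled by Fin n = {0,…,n-1} (shift by one).
-- A word of length n over Fin n is a one-line permutation iff its
-- entries are pairwise distinct.

Word : ℕ → Set
Word n = Vec (Fin n) n

IsPerm : ∀ {n} → Word n → Set
IsPerm w = Unique (toList w)

isPerm? : ∀ {n} → Decidable (IsPerm {n})
isPerm? w = allPairs? (λ x y → ¬? (x ≟ y)) (toList w)

allWords : (n m : ℕ) → List (Vec (Fin n) m)
allWords n zero    = Vec.[] ∷ []
allWords n (suc m) =
  List.concatMap (λ i → List.map (i Vec.∷_) (allWords n m)) (allFin n)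

-- Strategies.  S[k] (a permutation of [k], 1 ≤ k ≤ n) is stored as
-- S k′ for k = suc k′, k′ < n.

Strategy : ℕ → Set
Strategy n = (k : ℕ) → suc k ≤ n → Permutation′ (suc k)

IsDerangement : ∀ {k} → Permutation′ k → Set
IsDerangement {k} σ = (i : Fin k) → σ ⟨$⟩ʳ i ≢ i

firstGuess : (n : ℕ) → Word n
firstGuess n = Vec.allFin n

incorrect : ∀ {n} → Word n → Word n → List (Fin n)
incorrect {n} π γ = filter (λ i → ¬? (lookup γ i ≟ lookup π i)) (allFin n)

incorrect-≤ : ∀ {n} (π γ : Word n) → length (incorrect π γ) ≤ n
incorrect-≤ {n} π γ =
  ≤-trans (length-filter (λ i → ¬? (lookup γ i ≟ lookup π i)) (allFin n))
          (≤-reflexive (length-tabulate {n = n} (λ i → i)))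

-- Given I = (i_1 < … < i_k) as a vector, produce γ_{r+1} from γ_r:
-- γ_{r+1}(i) = γ_r(i) off I and γ_{r+1}(i_{σ(j)}) = γ_r(i_j), σ = S[k].
rearrange : ∀ {n k} → Strategy n → Vec (Fin n) k → k ≤ n → Word n → Word n
rearrange {n} {zero}  S I le γ = γ
rearrange {n} {suc k} S I le γ =
  List.foldl (λ δ j → δ [ lookup I (σ ⟨$⟩ʳ j) ]≔ lookup γ (lookup I j))
             γ (allFin (suc k))
  where σ = S k le

nextGuess : ∀ {n} → Strategy n → Word n → Word n → Word n
nextGuess S π γ = rearrange S (fromList (incorrect π γ)) (incorrect-≤ π γ) γ

-- guess S π r = γ_r  (r ≥ 1; guess S π 0 is given the value γ₁ as well,
-- it is never used).  Once γ_r = π the sequence is constant.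
guess : ∀ {n} → Strategy n → Word n → ℕ → Word n
guess {n} S π zero          = firstGuess n
guess {n} S π (suc zero)    = firstGuess n
guess {n} S π (suc (suc r)) = nextGuess S π (guess S π (suc r))

EndsAfter : ∀ {n} → Strategy n → ℕ → Word n → Set
EndsAfter S r π =
  (1 ≤ r) × (guess S π r ≡ π) × ((s : Fin (r ∸ 1)) → guess S π (suc (toℕ s)) ≢ π)

endsAfter? : ∀ {n} (S : Strategy n) (r : ℕ) → Decidable (EndsAfter S r)
endsAfter? {n} S r π =
  (1 ≤? r) ×-dec (≡-dec _≟_ (guess S π r) π)
    ×-dec all? (λ s → ¬? (≡-dec _≟_ (guess S π (suc (toℕ s))) π))

-- a_r = [x^r] f_S(x) : number of π ∈ S_n for which the game ends after
-- exactly r guesses.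
coeff : ∀ {n} → Strategy n → ℕ → ℕ
coeff {n} S r =
  length (filter (λ π → isPerm? π ×-dec endsAfter? S r π) (allWords n n))

descentsList : ∀ {n} → List (Fin n) → ℕ
descentsList []           = 0
descentsList (x ∷ [])     = 0
descentsList (x ∷ y ∷ xs) =
  (if isYes (y <? x) then 1 else 0) + descentsList (y ∷ xs)

descents : ∀ {n} → Word n → ℕ
descents w = descentsList (toList w)

eulerian1 : ℕ → ℕ
eulerian1 n =
  length (filter (λ π → isPerm? π ×-dec (descents π ≟ℕ 1)) (allWords n n))

-- For a permutation π ≠ γ₁ = id, the second guess permutes the entries of id at the
-- positions 𝓘₁ by the derangement S[|𝓘₁|], so it moves exactly the positions in 𝓘₁.
-- Hence the game ends after two guesses iff π is that rearrangement, and π ↦ 𝓘₁ is a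
-- bijection onto the subsets of [n] with at least two elements (a permutation cannot
-- differ from id in exactly one position).
--
-- A permutation with exactly one descent is its first ascending run T, listed
-- increasingly, followed by the complement of T, listed increasingly; so A(n,1) counts
-- the subsets T whose listing "T, then the rest" has exactly one descent. Splitting on whether 1
-- lies in T, both this count and the number of subsets with at least two elements
-- satisfy c(n+1) = c(n) + 2ⁿ − 1 with c(0) = 0, whence both equal 2ⁿ − n − 1.

module Submission where

open import Defs

open import Data.Bool using (Bool; true; false; T; if_then_else_)
open import Data.Bool.Properties using (T?)
open import Data.Empty using (⊥-elim)
open import Data.Fin using (Fin; zero; suc; _<?_) renaming (_<_ to _<ᶠ_; _≟_ to _≟ᶠ_)
open import Data.Fin.Permutation using (_⟨$⟩ʳ_; _⟨$⟩ˡ_; inverseʳ; inverseˡ)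
open import Data.Fin.Properties using (<-asym; <-trans; <-irrefl; ≤∧≢⇒<; any?)
open import Data.Fin.Subset using (Subset)
open import Data.List
  using (List; []; _∷_; length; filter; map; _++_; concatMap; cartesianProductWith; allFin; foldl)
import Data.List.Membership.DecPropositional as DecMembership
open import Data.List.Membership.Propositional using (_∈_; _∉_)
open import Data.List.Membership.Propositional.Properties
  using (∈-∃++; ∈-++⁻; ∈-++⁺ˡ; ∈-++⁺ʳ; ∈-map⁻; ∈-filter⁺; ∈-filter⁻; ∈-allFin;
         ∈-cartesianProductWith⁺)
open import Data.List.Properties
  using (length-map; length-++; filter-++; map-++; filter-≐; map-tabulate; length-tabulate)
open import Data.List.Relation.Binary.Subset.Propositional using (_⊆_)
open import Data.List.Relation.Unary.All as All using ()
open import Data.List.Relation.Unary.AllPairs using (AllPairs; []; _∷_)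
import Data.List.Relation.Unary.AllPairs.Properties as AllPairs
open import Data.List.Relation.Unary.Any using (here; there)
open import Data.List.Relation.Unary.Linked using (Linked; []; [-]; _∷_)
import Data.List.Relation.Unary.Linked.Properties as Linked
open import Data.List.Relation.Unary.Unique.Propositional using (Unique)
import Data.List.Relation.Unary.Unique.Propositional.Properties as Unique
open import Data.Nat
  using (ℕ; zero; suc; _≟_; _+_; _≤_; _^_; _∸_; z≤n; s≤s; _≤?_; s≤s⁻¹; s<s; s<s⁻¹)
open import Data.Nat.ListAction using (sum)
open import Data.Nat.Properties
  using (module ≤-Reasoning; 0≢1+n; 1+n≢0; ≮⇒≥; ≤-irrelevant; m≤m+n; n≮n; suc-injective;
         ≤-antisym; ≤-refl; ≤-trans; ≤-reflexive; +-suc; m+n∸n≡m)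
open import Data.Nat.Tactic.RingSolver using (solve-∀)
open import Data.Product using (_×_; _,_; proj₁; proj₂; ∃)
open import Data.Sum using (_⊎_; inj₁; inj₂)
open import Data.Unit using (⊤; tt)
open import Data.Vec using (Vec; []; _∷_; lookup; tabulate; toList; fromList; cast; _[_]≔_)
import Data.Vec.Membership.Propositional.Properties as VecMembership
open import Data.Vec.Properties
  using (lookup-allFin; lookup∘update; lookup∘update′; cast-is-id; toList-injective; ∷-injective;
         tabulate∘lookup; lookup∘tabulate; length-toList; toList∘fromList; toList-cast)
open import Data.Vec.Relation.Binary.Pointwise.Extensional using (ext; Pointwise-≡⇒≡)
import Data.Vec.Relation.Unary.All.Properties as VecAll
import Data.Vec.Relation.Unary.AllPairs as VecAllPairs
import Data.Vec.Relation.Unary.Any as VecAny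
open import Data.Vec.Relation.Unary.Any.Properties using (lookup-index)
import Data.Vec.Relation.Unary.Unique.Propositional as VecUnique
import Data.Vec.Relation.Unary.Unique.Propositional.Properties as VecUnique
open import Function using (_∘_; _⇔_; mk⇔; Equivalence)
open import Relation.Binary.PropositionalEquality
  using (_≡_; _≢_; refl; sym; trans; cong; cong₂; subst; module ≡-Reasoning)
open import Relation.Nullary using (yes; no; ¬_; ¬?)
open import Relation.Nullary.Decidable using (isYes; toWitness; fromWitness)
open import Relation.Unary using (Decidable; _≐_)
open import Relation.Unary.Properties using (∁?)

open module FinMembership {n} = DecMembership (_≟ᶠ_ {n}) using (_∈?_)

module _ {A B : Set} {P : B → Set} (P? : Decidable P) (f : A → B) where

  filter-map : ∀ xs → filter P? (map f xs) ≡ map f (filter (P? ∘ f) xs)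
  filter-map []       = refl
  filter-map (x ∷ xs) with P? (f x)
  ... | yes _ = cong (f x ∷_) (filter-map xs)
  ... | no  _ = filter-map xs

  length-filter-map : ∀ xs → length (filter P? (map f xs)) ≡ length (filter (P? ∘ f) xs)
  length-filter-map xs = trans (cong length (filter-map xs)) (length-map f (filter (P? ∘ f) xs))

module _ {A : Set} {P : A → Set} (P? : Decidable P) where

  length-filter+length-filter-∁ : ∀ xs →
    length (filter P? xs) + length (filter (∁? P?) xs) ≡ length xs
  length-filter+length-filter-∁ []       = refl
  length-filter+length-filter-∁ (x ∷ xs) with P? x
  ... | yes _ = cong suc (length-filter+length-filter-∁ xs)
  ... | no  _ = trans (+-suc _ _) (cong suc (length-filter+length-filter-∁ xs))

module _ {A : Set} where

  Unique-⊆⇒length≤ : ∀ {xs ys : List A} → Unique xs → xs ⊆ ys → length xs ≤ length ys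
  Unique-⊆⇒length≤ {[]}     _            _   = z≤n
  Unique-⊆⇒length≤ {x ∷ xs} (x∉xs ∷ uxs) xs⊆ys with ∈-∃++ (xs⊆ys (here refl))
  ... | ys₁ , ys₂ , refl = begin
    suc (length xs)                ≤⟨ s≤s (Unique-⊆⇒length≤ uxs xs⊆ys₁ys₂) ⟩
    suc (length (ys₁ ++ ys₂))      ≡⟨ cong suc (length-++ ys₁) ⟩
    suc (length ys₁ + length ys₂)  ≡⟨ +-suc (length ys₁) (length ys₂) ⟨
    length ys₁ + length (x ∷ ys₂)  ≡⟨ length-++ ys₁ ⟨
    length (ys₁ ++ x ∷ ys₂)        ∎
    where
    open ≤-Reasoning
    xs⊆ys₁ys₂ : xs ⊆ ys₁ ++ ys₂
    xs⊆ys₁ys₂ z∈xs with ∈-++⁻ ys₁ (xs⊆ys (there z∈xs))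
    ... | inj₁ z∈ys₁         = ∈-++⁺ˡ z∈ys₁
    ... | inj₂ (here refl)   = ⊥-elim (All.lookup x∉xs z∈xs refl)
    ... | inj₂ (there z∈ys₂) = ∈-++⁺ʳ ys₁ z∈ys₂

InjectiveOn : {A B : Set} → (A → B) → List A → Set
InjectiveOn f xs = ∀ {a a′} → a ∈ xs → a′ ∈ xs → f a ≡ f a′ → a ≡ a′

module _ {A B : Set} (f : A → B) where

  Unique-map⁺ : ∀ {xs} → InjectiveOn f xs → Unique xs → Unique (map f xs)
  Unique-map⁺ {[]}     _   []           = []
  Unique-map⁺ {x ∷ xs} inj (x∉xs ∷ uxs) =
    All.tabulate fx∉ ∷ Unique-map⁺ (λ p q → inj (there p) (there q)) uxs
    where
    fx∉ : ∀ {b} → b ∈ map f xs → f x ≢ b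
    fx∉ b∈ fx≡b with ∈-map⁻ f b∈
    ... | a , a∈xs , refl = All.lookup x∉xs a∈xs (inj (here refl) (there a∈xs) fx≡b)

  length≤-injectiveOn : ∀ {xs ys} → Unique xs → InjectiveOn f xs →
                        (∀ {a} → a ∈ xs → f a ∈ ys) → length xs ≤ length ys
  length≤-injectiveOn {xs} {ys} uxs inj into = begin
    length xs         ≡⟨ length-map f xs ⟨
    length (map f xs) ≤⟨ Unique-⊆⇒length≤ (Unique-map⁺ inj uxs) image⊆ys ⟩
    length ys         ∎
    where
    open ≤-Reasoning
    image⊆ys : map f xs ⊆ ys
    image⊆ys b∈ with ∈-map⁻ f b∈
    ... | a , a∈xs , refl = into a∈xs

Unique-++⇒disjoint : ∀ {A : Set} (xs : List A) {ys z} → Unique (xs ++ ys) → z ∈ xs → z ∉ ys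
Unique-++⇒disjoint (x ∷ xs) (x∉ ∷ _) (here refl)  z∈ys = All.lookup x∉ (∈-++⁺ʳ xs z∈ys) refl
Unique-++⇒disjoint (x ∷ xs) (_ ∷ u)  (there z∈xs) z∈ys = Unique-++⇒disjoint xs u z∈xs z∈ys

module _ {A : Set} where

  nonempty-member : ∀ {xs : List A} → 1 ≤ length xs → ∃ λ x → x ∈ xs
  nonempty-member {x ∷ _} _ = x , here refl

concatMap-map : {A B C : Set} (f : A → B → C) (xs : List A) (ys : List B) →
                concatMap (λ x → map (f x) ys) xs ≡ cartesianProductWith f xs ys
concatMap-map f []       ys = refl
concatMap-map f (x ∷ xs) ys = cong (map (f x) ys ++_) (concatMap-map f xs ys)

module _ {n : ℕ} where

  ⊆-antisym-increasing : ∀ {xs ys : List (Fin n)} → AllPairs _<ᶠ_ xs → AllPairs _<ᶠ_ ys →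
                         xs ⊆ ys → ys ⊆ xs → xs ≡ ys
  ⊆-antisym-increasing {[]}    {[]}    _ _ _     _     = refl
  ⊆-antisym-increasing {[]}    {y ∷ _} _ _ _     ys⊆xs with () ← ys⊆xs (here refl)
  ⊆-antisym-increasing {x ∷ _} {[]}    _ _ xs⊆ys _     with () ← xs⊆ys (here refl)
  ⊆-antisym-increasing {x ∷ xs} {y ∷ ys} (x<xs ∷ xs-inc) (y<ys ∷ ys-inc) xs⊆ys ys⊆xs =
    cong₂ _∷_ x≡y
      (⊆-antisym-increasing xs-inc ys-inc (tail⊆ x<xs xs⊆ys x≡y) (tail⊆ y<ys ys⊆xs (sym x≡y)))
    where
    x≡y : x ≡ y
    x≡y with xs⊆ys (here refl) | ys⊆xs (here refl)
    ... | here x≡y  | _         = x≡y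
    ... | there _   | here y≡x  = sym y≡x
    ... | there x∈ys | there y∈xs = ⊥-elim (<-asym (All.lookup y<ys x∈ys) (All.lookup x<xs y∈xs))
    tail⊆ : ∀ {a b as bs} → All.All (a <ᶠ_) as → a ∷ as ⊆ b ∷ bs → a ≡ b → as ⊆ bs
    tail⊆ a<as as⊆bs refl z∈as with as⊆bs (there z∈as)
    ... | here refl  = ⊥-elim (<-irrefl refl (All.lookup a<as z∈as))
    ... | there z∈bs = z∈bs

module _ {A : Set} where

  Unique-toList⁺ : ∀ {m} {v : Vec A m} → VecUnique.Unique v → Unique (toList v)
  Unique-toList⁺ VecAllPairs.[]           = []
  Unique-toList⁺ (x∉v VecAllPairs.∷ uv) = VecAll.toList⁺ x∉v ∷ Unique-toList⁺ uv

  Unique-toList⁻ : ∀ {m} {v : Vec A m} → Unique (toList v) → VecUnique.Unique v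
  Unique-toList⁻ {v = []}    []         = VecAllPairs.[]
  Unique-toList⁻ {v = _ ∷ _} (x∉v ∷ uv) = VecAll.toList⁻ x∉v VecAllPairs.∷ Unique-toList⁻ uv

  Unique-toList⇒lookup-injective : ∀ {m} {v : Vec A m} → Unique (toList v) →
                                   ∀ {i j} → lookup v i ≡ lookup v j → i ≡ j
  Unique-toList⇒lookup-injective uv = VecUnique.lookup-injective (Unique-toList⁻ uv) _ _

  lookup-injective⇒Unique-toList : ∀ {m} (v : Vec A m) →
    (∀ {i j} → lookup v i ≡ lookup v j → i ≡ j) → Unique (toList v)
  lookup-injective⇒Unique-toList v inj =
    Unique-toList⁺ (subst VecUnique.Unique (tabulate∘lookup v) (VecUnique.tabulate⁺ inj))

module _ {A : Set} where

  ∈-fromList⇒lookup : ∀ {x} {xs : List A} → x ∈ xs → ∃ λ m → lookup (fromList xs) m ≡ x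
  ∈-fromList⇒lookup x∈xs = VecAny.index x∈ , sym (lookup-index x∈)
    where x∈ = VecMembership.∈-fromList⁺ x∈xs

  lookup-fromList-∈ : ∀ (xs : List A) m → lookup (fromList xs) m ∈ xs
  lookup-fromList-∈ xs m = VecMembership.∈-fromList⁻ (VecMembership.∈-lookup m (fromList xs))

  Unique⇒lookup-fromList-injective : ∀ {xs : List A} → Unique xs →
    ∀ {a b} → lookup (fromList xs) a ≡ lookup (fromList xs) b → a ≡ b
  Unique⇒lookup-fromList-injective {xs} uxs =
    Unique-toList⇒lookup-injective (subst Unique (sym (toList∘fromList xs)) uxs)

IsPerm⇒∈ : ∀ {n} {w : Word n} → IsPerm w → ∀ v → v ∈ toList w
IsPerm⇒∈ {n} {w} uw v with v ∈? toList w
... | yes v∈w = v∈w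
... | no  v∉w = ⊥-elim (n≮n n (begin-strict
  n                      ≡⟨ length-toList w ⟨
  length (toList w)      <⟨ ≤-refl ⟩
  length (v ∷ toList w)  ≤⟨ Unique-⊆⇒length≤ unique-v∷w (λ {z} _ → ∈-allFin z) ⟩
  length (allFin n)      ≡⟨ length-tabulate (λ i → i) ⟩
  n                      ∎))
  where
  open ≤-Reasoning
  unique-v∷w : Unique (v ∷ toList w)
  unique-v∷w = All.tabulate (λ z∈w v≡z → v∉w (subst (_∈ toList w) (sym v≡z) z∈w)) ∷ uw

record Enumeration (A : Set) : Set where
  field
    elements : List A
    unique   : Unique elements
    complete : ∀ a → a ∈ elements
open Enumeration

count : {A : Set} {P : A → Set} → Decidable P → Enumeration A → ℕ
count P? E = length (filter P? (elements E))

count-≐ : {A : Set} {P Q : A → Set} (P? : Decidable P) (Q? : Decidable Q) → P ≐ Q →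
          (E : Enumeration A) → count P? E ≡ count Q? E
count-≐ P? Q? P≐Q E = cong length (filter-≐ P? Q? P≐Q (elements E))

module _ {A B : Set} {P : A → Set} {Q : B → Set} (P? : Decidable P) (Q? : Decidable Q)
         (EA : Enumeration A) (EB : Enumeration B) where

  count-≤ : (f : A → B) (g : B → A) → (∀ {a} → P a → Q (f a)) → (∀ {a} → P a → g (f a) ≡ a) →
            count P? EA ≤ count Q? EB
  count-≤ f g f⁺ gf = length≤-injectiveOn f (Unique.filter⁺ P? (unique EA)) inj into
    where
    P-of : ∀ {a} → a ∈ filter P? (elements EA) → P a
    P-of a∈ = proj₂ (∈-filter⁻ P? {xs = elements EA} a∈)
    inj : InjectiveOn f (filter P? (elements EA))
    inj p q fa≡fa′ = trans (sym (gf (P-of p))) (trans (cong g fa≡fa′) (gf (P-of q)))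
    into : ∀ {a} → a ∈ filter P? (elements EA) → f a ∈ filter Q? (elements EB)
    into a∈ = ∈-filter⁺ Q? (complete EB _) (f⁺ (P-of a∈))

module _ {A B : Set} {P : A → Set} {Q : B → Set} (P? : Decidable P) (Q? : Decidable Q)
         (EA : Enumeration A) (EB : Enumeration B) where

  count-bijection : (f : A → B) (g : B → A) →
                    (∀ {a} → P a → Q (f a)) → (∀ {b} → Q b → P (g b)) →
                    (∀ {a} → P a → g (f a) ≡ a) → (∀ {b} → Q b → f (g b) ≡ b) →
                    count P? EA ≡ count Q? EB
  count-bijection f g f⁺ g⁺ gf fg =
    ≤-antisym (count-≤ P? Q? EA EB f g f⁺ gf) (count-≤ Q? P? EB EA g f g⁺ fg)

module _ {A : Set} where

  allVecs : List A → (m : ℕ) → List (Vec A m)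
  allVecs xs zero    = [] ∷ []
  allVecs xs (suc m) = cartesianProductWith _∷_ xs (allVecs xs m)

  vectors : Enumeration A → (m : ℕ) → Enumeration (Vec A m)
  vectors E m = record
    { elements = allVecs (elements E) m
    ; unique   = unique′ m
    ; complete = complete′ m
    }
    where
    unique′ : ∀ m → Unique (allVecs (elements E) m)
    unique′ zero    = All.[] ∷ []
    unique′ (suc m) = Unique.cartesianProductWith⁺ _∷_ ∷-injective (unique E) (unique′ m)
    complete′ : ∀ m (v : Vec A m) → v ∈ allVecs (elements E) m
    complete′ zero    []      = here refl
    complete′ (suc m) (x ∷ v) = ∈-cartesianProductWith⁺ _∷_ (complete E x) (complete′ m v)

  count-cartesianProduct : ∀ {m} {P : Vec A (suc m) → Set} (P? : Decidable P) xs (vs : List (Vec A m)) →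
    length (filter P? (cartesianProductWith _∷_ xs vs))
      ≡ sum (map (λ x → length (filter (λ v → P? (x ∷ v)) vs)) xs)
  count-cartesianProduct P? []       vs = refl
  count-cartesianProduct P? (x ∷ xs) vs = begin
    length (filter P? (map (x ∷_) vs ++ cartesianProductWith _∷_ xs vs))
      ≡⟨ cong length (filter-++ P? (map (x ∷_) vs) _) ⟩
    length (filter P? (map (x ∷_) vs) ++ filter P? (cartesianProductWith _∷_ xs vs))
      ≡⟨ length-++ (filter P? (map (x ∷_) vs)) ⟩
    length (filter P? (map (x ∷_) vs)) + length (filter P? (cartesianProductWith _∷_ xs vs))
      ≡⟨ cong₂ _+_ (length-filter-map P? (x ∷_) vs) (count-cartesianProduct P? xs vs) ⟩
    length (filter (λ v → P? (x ∷ v)) vs)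
      + sum (map (λ y → length (filter (λ v → P? (y ∷ v)) vs)) xs) ∎
    where open ≡-Reasoning

allWords≡allVecs : ∀ n m → allWords n m ≡ allVecs (allFin n) m
allWords≡allVecs n zero    = refl
allWords≡allVecs n (suc m) = begin
  concatMap (λ i → map (i ∷_) (allWords n m)) (allFin n)
    ≡⟨ cong (λ ws → concatMap (λ i → map (i ∷_) ws) (allFin n)) (allWords≡allVecs n m) ⟩
  concatMap (λ i → map (i ∷_) (allVecs (allFin n) m)) (allFin n)
    ≡⟨ concatMap-map _∷_ (allFin n) _ ⟩
  allVecs (allFin n) (suc m) ∎
  where open ≡-Reasoning

fins : (n : ℕ) → Enumeration (Fin n)
fins n = record { elements = allFin n ; unique = Unique.allFin⁺ n ; complete = ∈-allFin }

words : (n m : ℕ) → Enumeration (Vec (Fin n) m)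
words n m = record
  { elements = allWords n m
  ; unique   = subst Unique (sym eq) (unique (vectors (fins n) m))
  ; complete = λ w → subst (w ∈_) (sym eq) (complete (vectors (fins n) m) w)
  }
  where eq = allWords≡allVecs n m

booleans : Enumeration Bool
booleans = record
  { elements = true ∷ false ∷ []
  ; unique   = ((λ ()) All.∷ All.[]) ∷ All.[] ∷ []
  ; complete = λ { true → here refl ; false → there (here refl) }
  }

subsets : (n : ℕ) → Enumeration (Subset n)
subsets = vectors booleans

count-subsets-suc : ∀ {n} {P : Subset (suc n) → Set} (P? : Decidable P) →
  count P? (subsets (suc n))
    ≡ count (λ b → P? (true ∷ b)) (subsets n) + (count (λ b → P? (false ∷ b)) (subsets n) + 0)
count-subsets-suc {n} P? = count-cartesianProduct P? (true ∷ false ∷ []) (elements (subsets n))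

units : Enumeration ⊤
units = record { elements = tt ∷ [] ; unique = All.[] ∷ [] ; complete = λ { tt → here refl } }

-- Subsets of Fin n as increasing lists

module _ {n : ℕ} where

  inside? : (b : Subset n) → Decidable (λ i → T (lookup b i))
  inside? b i = T? (lookup b i)

  members : Subset n → List (Fin n)
  members b = filter (inside? b) (allFin n)

  nonMembers : Subset n → List (Fin n)
  nonMembers b = filter (∁? (inside? b)) (allFin n)

  ∈-members⁺ : ∀ b {i} → T (lookup b i) → i ∈ members b
  ∈-members⁺ b = ∈-filter⁺ (inside? b) (∈-allFin _)

  ∈-members⁻ : ∀ b {i} → i ∈ members b → T (lookup b i)
  ∈-members⁻ b i∈ = proj₂ (∈-filter⁻ (inside? b) {xs = allFin n} i∈)

  ∈-nonMembers⁻ : ∀ b {i} → i ∈ nonMembers b → ¬ T (lookup b i)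
  ∈-nonMembers⁻ b i∈ = proj₂ (∈-filter⁻ (∁? (inside? b)) {xs = allFin n} i∈)

  length-members+nonMembers : ∀ b → length (members b) + length (nonMembers b) ≡ n
  length-members+nonMembers b =
    trans (length-filter+length-filter-∁ _ (allFin n)) (length-tabulate (λ i → i))

  filter-allFin-increasing : ∀ {P : Fin n → Set} (P? : Decidable P) →
                             AllPairs _<ᶠ_ (filter P? (allFin n))
  filter-allFin-increasing P? = AllPairs.filter⁺ P? (AllPairs.tabulate⁺-< (λ i<j → i<j))

  members-increasing : ∀ b → AllPairs _<ᶠ_ (members b)
  members-increasing b = filter-allFin-increasing (inside? b)

  nonMembers-increasing : ∀ b → AllPairs _<ᶠ_ (nonMembers b)
  nonMembers-increasing b = filter-allFin-increasing (∁? (inside? b))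

module _ {n : ℕ} (b : Subset n) where

  private
    allFin-suc : allFin (suc n) ≡ zero ∷ map suc (allFin n)
    allFin-suc = cong (zero ∷_) (sym (map-tabulate (λ i → i) suc))

  members-true : members (true ∷ b) ≡ zero ∷ map suc (members b)
  members-true =
    trans (cong (filter (inside? (true ∷ b))) allFin-suc)
          (cong (zero ∷_) (filter-map (inside? (true ∷ b)) suc (allFin n)))

  members-false : members (false ∷ b) ≡ map suc (members b)
  members-false =
    trans (cong (filter (inside? (false ∷ b))) allFin-suc)
          (filter-map (inside? (false ∷ b)) suc (allFin n))

  nonMembers-true : nonMembers (true ∷ b) ≡ map suc (nonMembers b)
  nonMembers-true =
    trans (cong (filter (∁? (inside? (true ∷ b)))) allFin-suc)
          (filter-map (∁? (inside? (true ∷ b))) suc (allFin n))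

  nonMembers-false : nonMembers (false ∷ b) ≡ zero ∷ map suc (nonMembers b)
  nonMembers-false =
    trans (cong (filter (∁? (inside? (false ∷ b)))) allFin-suc)
          (cong (zero ∷_) (filter-map (∁? (inside? (false ∷ b))) suc (allFin n)))

length-members-true : ∀ {n} (b : Subset n) → length (members (true ∷ b)) ≡ suc (length (members b))
length-members-true b = trans (cong length (members-true b)) (cong suc (length-map suc (members b)))

length-members-false : ∀ {n} (b : Subset n) → length (members (false ∷ b)) ≡ length (members b)
length-members-false b = trans (cong length (members-false b)) (length-map suc (members b))

T-injective : ∀ {a b : Bool} → (T a → T b) → (T b → T a) → a ≡ b
T-injective {false} {false} _ _ = refl
T-injective {false} {true}  _ b⇒a = ⊥-elim (b⇒a _)
T-injective {true}  {false} a⇒b _ = ⊥-elim (a⇒b _)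
T-injective {true}  {true}  _ _ = refl

module _ {n : ℕ} where

  members-injective : ∀ {b b′ : Subset n} → members b ≡ members b′ → b ≡ b′
  members-injective {b} {b′} eq = Pointwise-≡⇒≡ (ext λ i →
    T-injective (λ t → ∈-members⁻ b′ (subst (i ∈_) eq (∈-members⁺ b t)))
                (λ t → ∈-members⁻ b (subst (i ∈_) (sym eq) (∈-members⁺ b′ t))))

  module _ {P : Fin n → Set} (P? : Decidable P) where

    private
      inside⇔P : (λ i → T (lookup (tabulate (isYes ∘ P?)) i)) ≐ P
      inside⇔P = (λ {i} t → toWitness (subst T (lookup∘tabulate (isYes ∘ P?) i) t))
               , (λ {i} p → subst T (sym (lookup∘tabulate (isYes ∘ P?) i)) (fromWitness p))

    members-tabulate : members (tabulate (isYes ∘ P?)) ≡ filter P? (allFin n)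
    members-tabulate = filter-≐ _ P? inside⇔P (allFin n)

    nonMembers-tabulate : nonMembers (tabulate (isYes ∘ P?)) ≡ filter (∁? P?) (allFin n)
    nonMembers-tabulate =
      filter-≐ _ (∁? P?) ((λ ¬t → ¬t ∘ proj₂ inside⇔P) , (λ ¬p → ¬p ∘ proj₁ inside⇔P)) (allFin n)

  indicator : List (Fin n) → Subset n
  indicator xs = tabulate (λ z → isYes (z ∈? xs))

  members-indicator : ∀ {xs} → AllPairs _<ᶠ_ xs → members (indicator xs) ≡ xs
  members-indicator {xs} xs-inc = trans (members-tabulate (_∈? xs))
    (⊆-antisym-increasing (filter-allFin-increasing (_∈? xs)) xs-inc
      (λ z∈ → proj₂ (∈-filter⁻ (_∈? xs) {xs = allFin n} z∈))
      (λ z∈ → ∈-filter⁺ (_∈? xs) (∈-allFin _) z∈))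

  nonMembers-indicator : ∀ {xs ys} → AllPairs _<ᶠ_ ys →
    (∀ {z} → z ∉ xs → z ∈ ys) → (∀ {z} → z ∈ ys → z ∉ xs) → nonMembers (indicator xs) ≡ ys
  nonMembers-indicator {xs} ys-inc ∉xs⇒∈ys ∈ys⇒∉xs = trans (nonMembers-tabulate (_∈? xs))
    (⊆-antisym-increasing (filter-allFin-increasing (∁? (_∈? xs))) ys-inc
      (λ z∈ → ∉xs⇒∈ys (proj₂ (∈-filter⁻ (∁? (_∈? xs)) {xs = allFin n} z∈)))
      (λ z∈ → ∈-filter⁺ (∁? (_∈? xs)) (∈-allFin _) (∈ys⇒∉xs z∈)))

-- Counting subsets by size

atLeast : ℕ → ℕ → ℕ
atLeast k n = count (λ (b : Subset n) → k ≤? length (members b)) (subsets n)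

atLeast-zero : ∀ n → atLeast 0 n ≡ 2 ^ n
atLeast-zero zero    = refl
atLeast-zero (suc n) = begin
  atLeast 0 (suc n)                ≡⟨ count-subsets-suc {n} (λ b → 0 ≤? length (members b)) ⟩
  count _ (subsets n) + (count _ (subsets n) + 0)
    ≡⟨ cong₂ (λ x y → x + (y + 0)) (count-≐ _ _ ((λ _ → z≤n) , (λ _ → z≤n)) (subsets n))
                                   (count-≐ _ _ ((λ _ → z≤n) , (λ _ → z≤n)) (subsets n)) ⟩
  atLeast 0 n + (atLeast 0 n + 0)  ≡⟨ cong (λ x → x + (x + 0)) (atLeast-zero n) ⟩
  2 ^ suc n                        ∎
  where
  open ≡-Reasoning

atLeast-suc : ∀ k n → atLeast (suc k) (suc n) ≡ atLeast k n + (atLeast (suc k) n + 0)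
atLeast-suc k n = trans (count-subsets-suc {n} (λ b → suc k ≤? length (members b)))
  (cong₂ (λ x y → x + (y + 0))
    (count-≐ _ _ ((λ {b} le → s≤s⁻¹ (≤-trans le (≤-reflexive (length-members-true b))))
                 , (λ {b} le → ≤-trans (s≤s le) (≤-reflexive (sym (length-members-true b)))))
             (subsets n))
    (count-≐ _ _ ((λ {b} le → ≤-trans le (≤-reflexive (length-members-false b)))
                 , (λ {b} le → ≤-trans le (≤-reflexive (sym (length-members-false b)))))
             (subsets n)))

atLeast-one : ∀ n → atLeast 1 n + 1 ≡ 2 ^ n
atLeast-one zero    = refl
atLeast-one (suc n) = begin
  atLeast 1 (suc n) + 1
    ≡⟨ cong (_+ 1) (atLeast-suc 0 n) ⟩
  atLeast 0 n + (atLeast 1 n + 0) + 1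
    ≡⟨ regroup (atLeast 0 n) (atLeast 1 n) ⟩
  atLeast 0 n + ((atLeast 1 n + 1) + 0)
    ≡⟨ cong₂ (λ x y → x + (y + 0)) (atLeast-zero n) (atLeast-one n) ⟩
  2 ^ suc n ∎
  where
  open ≡-Reasoning
  regroup : ∀ a b → a + (b + 0) + 1 ≡ a + ((b + 1) + 0)
  regroup = solve-∀

atLeast-two : ∀ n → atLeast 2 n + 1 + n ≡ 2 ^ n
atLeast-two zero    = refl
atLeast-two (suc n) = begin
  atLeast 2 (suc n) + 1 + suc n
    ≡⟨ cong (λ x → x + 1 + suc n) (atLeast-suc 1 n) ⟩
  atLeast 1 n + (atLeast 2 n + 0) + 1 + suc n
    ≡⟨ regroup (atLeast 1 n) (atLeast 2 n) n ⟩
  (atLeast 1 n + 1) + ((atLeast 2 n + 1 + n) + 0)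
    ≡⟨ cong₂ (λ x y → x + (y + 0)) (atLeast-one n) (atLeast-two n) ⟩
  2 ^ suc n ∎
  where
  open ≡-Reasoning
  regroup : ∀ a b m → a + (b + 0) + 1 + suc m ≡ (a + 1) + ((b + 1 + m) + 0)
  regroup = solve-∀

atLeast-two-∸ : ∀ n → atLeast 2 n ≡ 2 ^ n ∸ n ∸ 1
atLeast-two-∸ n = sym (begin
  2 ^ n ∸ n ∸ 1                  ≡⟨ cong (λ x → x ∸ n ∸ 1) (atLeast-two n) ⟨
  atLeast 2 n + 1 + n ∸ n ∸ 1    ≡⟨ cong (_∸ 1) (m+n∸n≡m (atLeast 2 n + 1) n) ⟩
  atLeast 2 n + 1 ∸ 1            ≡⟨ m+n∸n≡m (atLeast 2 n) 1 ⟩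
  atLeast 2 n                    ∎)
  where open ≡-Reasoning

module _ {n : ℕ} {x y : Fin n} (l : List (Fin n)) where

  descentsList-ascent : ¬ y <ᶠ x → descentsList (x ∷ y ∷ l) ≡ descentsList (y ∷ l)
  descentsList-ascent y≮x with y <? x
  ... | yes y<x = ⊥-elim (y≮x y<x)
  ... | no  _   = refl

  descentsList-descent : y <ᶠ x → descentsList (x ∷ y ∷ l) ≡ suc (descentsList (y ∷ l))
  descentsList-descent y<x with y <? x
  ... | yes _   = refl
  ... | no  y≮x = ⊥-elim (y≮x y<x)

increasing⇒noDescent : ∀ {n} {l : List (Fin n)} → AllPairs _<ᶠ_ l → descentsList l ≡ 0
increasing⇒noDescent []                = refl
increasing⇒noDescent (_ ∷ [])          = refl
increasing⇒noDescent {l = _ ∷ _ ∷ l} ((x<y All.∷ _) ∷ inc) =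
  trans (descentsList-ascent l (<-asym x<y)) (increasing⇒noDescent inc)

descentsList-map-suc : ∀ {n} (l : List (Fin n)) → descentsList (map suc l) ≡ descentsList l
descentsList-map-suc []          = refl
descentsList-map-suc (x ∷ [])     = refl
descentsList-map-suc (x ∷ y ∷ l) with ih ← descentsList-map-suc (y ∷ l) | y <? x
... | yes y<x = trans (descentsList-descent (map suc l) (s<s y<x)) (cong suc ih)
... | no  y≮x = trans (descentsList-ascent (map suc l) (y≮x ∘ s<s⁻¹)) ih

descentsList-zero∷ : ∀ {n} (l : List (Fin (suc n))) → descentsList (zero ∷ l) ≡ descentsList l
descentsList-zero∷ []      = refl
descentsList-zero∷ (y ∷ l) = descentsList-ascent {x = zero} l (λ ())

descentsList-shift : ∀ {n} {x : Fin n} {l r} → AllPairs _<ᶠ_ (x ∷ l) → descentsList r ≡ 0 →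
                     descentsList (map suc (x ∷ l) ++ zero ∷ r) ≡ 1
descentsList-shift {x = x} {l = []} {r} _ r-inc =
  trans (descentsList-descent {x = suc x} r (s≤s z≤n)) (cong suc (trans (descentsList-zero∷ r) r-inc))
descentsList-shift {l = y ∷ l} {r} ((x<y All.∷ _) ∷ inc) r-inc =
  trans (descentsList-ascent (map suc l ++ zero ∷ r) (<-asym (s<s x<y))) (descentsList-shift inc r-inc)

descentsList-shift≡1⇔ : ∀ {n} (l : List (Fin n)) {r} → AllPairs _<ᶠ_ l → descentsList r ≡ 0 →
                        descentsList (map suc l ++ zero ∷ r) ≡ 1 ⇔ 1 ≤ length l
descentsList-shift≡1⇔ []      {r} _   r-inc =
  mk⇔ (λ d → ⊥-elim (0≢1+n (trans (sym r-inc) (trans (sym (descentsList-zero∷ r)) d)))) (λ ())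
descentsList-shift≡1⇔ (_ ∷ _)     inc r-inc =
  mk⇔ (λ _ → s≤s z≤n) (λ _ → descentsList-shift inc r-inc)

membersFirst : ∀ {n} → Subset n → List (Fin n)
membersFirst b = members b ++ nonMembers b

descentsList-membersFirst-true : ∀ {n} (b : Subset n) →
  descentsList (membersFirst (true ∷ b)) ≡ descentsList (membersFirst b)
descentsList-membersFirst-true b = begin
  descentsList (members (true ∷ b) ++ nonMembers (true ∷ b))
    ≡⟨ cong₂ (λ xs ys → descentsList (xs ++ ys)) (members-true b) (nonMembers-true b) ⟩
  descentsList (zero ∷ map suc (members b) ++ map suc (nonMembers b))
    ≡⟨ descentsList-zero∷ (map suc (members b) ++ map suc (nonMembers b)) ⟩
  descentsList (map suc (members b) ++ map suc (nonMembers b))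
    ≡⟨ cong descentsList (map-++ suc (members b) (nonMembers b)) ⟨
  descentsList (map suc (membersFirst b))
    ≡⟨ descentsList-map-suc (membersFirst b) ⟩
  descentsList (membersFirst b) ∎
  where open ≡-Reasoning

descentsList-membersFirst-false : ∀ {n} (b : Subset n) →
  descentsList (membersFirst (false ∷ b)) ≡ 1 ⇔ 1 ≤ length (members b)
descentsList-membersFirst-false b =
  subst (λ xs → descentsList xs ≡ 1 ⇔ 1 ≤ length (members b))
        (sym (cong₂ _++_ (members-false b) (nonMembers-false b)))
        (descentsList-shift≡1⇔ (members b) (members-increasing b)
          (trans (descentsList-map-suc (nonMembers b)) (increasing⇒noDescent (nonMembers-increasing b))))

oneDescentSubsets : ℕ → ℕ
oneDescentSubsets n = count (λ (b : Subset n) → descentsList (membersFirst b) ≟ 1) (subsets n)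

oneDescentSubsets≡atLeast-two : ∀ n → oneDescentSubsets n ≡ atLeast 2 n
oneDescentSubsets≡atLeast-two zero    = refl
oneDescentSubsets≡atLeast-two (suc n) = begin
  oneDescentSubsets (suc n)
    ≡⟨ count-subsets-suc {n} (λ b → descentsList (membersFirst b) ≟ 1) ⟩
  count _ (subsets n) + (count _ (subsets n) + 0)
    ≡⟨ cong₂ (λ x y → x + (y + 0))
         (count-≐ _ _ ((λ {b} d → trans (sym (descentsList-membersFirst-true b)) d)
                      , (λ {b} d → trans (descentsList-membersFirst-true b) d)) (subsets n))
         (count-≐ _ _ ((λ {b} → Equivalence.to (descentsList-membersFirst-false b))
                      , (λ {b} → Equivalence.from (descentsList-membersFirst-false b))) (subsets n)) ⟩
  oneDescentSubsets n + (atLeast 1 n + 0)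
    ≡⟨ cong (λ x → x + (atLeast 1 n + 0)) (oneDescentSubsets≡atLeast-two n) ⟩
  atLeast 2 n + (atLeast 1 n + 0)
    ≡⟨ swap (atLeast 2 n) (atLeast 1 n) ⟩
  atLeast 1 n + (atLeast 2 n + 0)
    ≡⟨ atLeast-suc 1 n ⟨
  atLeast 2 (suc n) ∎
  where
  open ≡-Reasoning
  swap : ∀ a b → a + (b + 0) ≡ b + (a + 0)
  swap = solve-∀

-- Permutations with one descent

ascentFrom : ∀ {n} → Fin n → List (Fin n) → List (Fin n)
ascentFrom x []      = []
ascentFrom x (y ∷ l) = if isYes (y <? x) then [] else y ∷ ascentFrom y l

ascendingPrefix : ∀ {n} → List (Fin n) → List (Fin n)
ascendingPrefix []      = []
ascendingPrefix (x ∷ l) = x ∷ ascentFrom x l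

module _ {n : ℕ} where

  private
    ≢∧≮⇒< : {x y : Fin n} → x ≢ y → ¬ y <ᶠ x → x <ᶠ y
    ≢∧≮⇒< x≢y y≮x = ≤∧≢⇒< (≮⇒≥ y≮x) x≢y

  noDescent⇒increasing : ∀ {l : List (Fin n)} → AllPairs _≢_ l → descentsList l ≡ 0 →
                         Linked _<ᶠ_ l
  noDescent⇒increasing {[]}        _                 _ = []
  noDescent⇒increasing {_ ∷ []}    _                 _ = [-]
  noDescent⇒increasing {x ∷ y ∷ l} ((x≢y All.∷ _) ∷ distinct) d with y <? x
  ... | yes _   = ⊥-elim (1+n≢0 d)
  ... | no  y≮x = ≢∧≮⇒< x≢y y≮x ∷ noDescent⇒increasing distinct d

  oneDescent-split : ∀ x (l : List (Fin n)) → AllPairs _≢_ (x ∷ l) → descentsList (x ∷ l) ≡ 1 →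
    ∃ λ ys → l ≡ ascentFrom x l ++ ys × Linked _<ᶠ_ (x ∷ ascentFrom x l) × Linked _<ᶠ_ ys
  oneDescent-split x (y ∷ l) ((x≢y All.∷ _) ∷ distinct) d with y <? x
  ... | yes _   = y ∷ l , refl , [-] , noDescent⇒increasing distinct (suc-injective d)
  ... | no  y≮x with oneDescent-split y l distinct d
  ...   | ys , l≡ , prefix-inc , ys-inc =
    ys , cong (y ∷_) l≡ , ≢∧≮⇒< x≢y y≮x ∷ prefix-inc , ys-inc

  ascentFrom-++ : ∀ {x} {xs ys : List (Fin n)} → AllPairs _<ᶠ_ (x ∷ xs) → AllPairs _<ᶠ_ ys →
                  descentsList (x ∷ xs ++ ys) ≡ 1 → ascentFrom x (xs ++ ys) ≡ xs
  ascentFrom-++ {x} {[]} {[]}    _ _ ()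
  ascentFrom-++ {x} {[]} {y ∷ ys} _ ys-inc d with y <? x
  ... | yes _ = refl
  ... | no  _ = ⊥-elim (1+n≢0 (trans (sym d) (increasing⇒noDescent ys-inc)))
  ascentFrom-++ {x} {x′ ∷ xs} ((x<x′ All.∷ _) ∷ xs-inc) ys-inc d with x′ <? x
  ... | yes x′<x = ⊥-elim (<-asym x<x′ x′<x)
  ... | no  _    = cong (x′ ∷_) (ascentFrom-++ xs-inc ys-inc d)

  ascendingPrefix-++ : ∀ {xs ys : List (Fin n)} → AllPairs _<ᶠ_ xs → AllPairs _<ᶠ_ ys →
                       descentsList (xs ++ ys) ≡ 1 → ascendingPrefix (xs ++ ys) ≡ xs
  ascendingPrefix-++ {[]}    _      ys-inc d =
    ⊥-elim (1+n≢0 (trans (sym d) (increasing⇒noDescent ys-inc)))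
  ascendingPrefix-++ {x ∷ _} xs-inc ys-inc d = cong (x ∷_) (ascentFrom-++ xs-inc ys-inc d)

module _ {n : ℕ} where

  membersFirst-indicator : ∀ (l : List (Fin n)) → Unique l → (∀ v → v ∈ l) →
    descentsList l ≡ 1 → membersFirst (indicator (ascendingPrefix l)) ≡ l
  membersFirst-indicator (x ∷ l) ul complete d with oneDescent-split x l ul d
  ... | ys , l≡ , prefix-inc , ys-inc = begin
    members (indicator prefix) ++ nonMembers (indicator prefix)
      ≡⟨ cong₂ _++_ (members-indicator prefix-inc′)
                    (nonMembers-indicator ys-inc′ ∉prefix⇒∈ys ∈ys⇒∉prefix) ⟩
    prefix ++ ys
      ≡⟨ cong (x ∷_) l≡ ⟨
    x ∷ l ∎
    where
    open ≡-Reasoning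
    prefix = x ∷ ascentFrom x l
    prefix-inc′ = Linked.Linked⇒AllPairs <-trans prefix-inc
    ys-inc′ = Linked.Linked⇒AllPairs <-trans ys-inc
    u : Unique (prefix ++ ys)
    u = subst Unique (cong (x ∷_) l≡) ul
    ∈ys⇒∉prefix : ∀ {z} → z ∈ ys → z ∉ prefix
    ∈ys⇒∉prefix z∈ys z∈prefix = Unique-++⇒disjoint prefix u z∈prefix z∈ys
    ∉prefix⇒∈ys : ∀ {z} → z ∉ prefix → z ∈ ys
    ∉prefix⇒∈ys {z} z∉prefix with ∈-++⁻ prefix (subst (z ∈_) (cong (x ∷_) l≡) (complete z))
    ... | inj₁ z∈prefix = ⊥-elim (z∉prefix z∈prefix)
    ... | inj₂ z∈ys     = z∈ys

module _ (n : ℕ) where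

  membersFirstWord : Subset n → Word n
  membersFirstWord b =
    cast (trans (length-++ (members b)) (length-members+nonMembers b)) (fromList (membersFirst b))

  toList-membersFirstWord : ∀ b → toList (membersFirstWord b) ≡ membersFirst b
  toList-membersFirstWord b =
    trans (toList-cast _ (fromList (membersFirst b))) (toList∘fromList (membersFirst b))

  ascendingSet : Word n → Subset n
  ascendingSet π = indicator (ascendingPrefix (toList π))

  membersFirstWord-IsPerm : ∀ b → IsPerm (membersFirstWord b)
  membersFirstWord-IsPerm b = subst Unique (sym (toList-membersFirstWord b))
    (Unique.++⁺ (Unique.filter⁺ _ (Unique.allFin⁺ n)) (Unique.filter⁺ _ (Unique.allFin⁺ n))
      (λ (i∈ , i∉) → ∈-nonMembers⁻ b i∉ (∈-members⁻ b i∈)))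

  ascendingSet-membersFirstWord : ∀ b → descentsList (membersFirst b) ≡ 1 →
                                  ascendingSet (membersFirstWord b) ≡ b
  ascendingSet-membersFirstWord b d = members-injective (begin
    members (indicator (ascendingPrefix (toList (membersFirstWord b))))
      ≡⟨ cong (members ∘ indicator ∘ ascendingPrefix) (toList-membersFirstWord b) ⟩
    members (indicator (ascendingPrefix (membersFirst b)))
      ≡⟨ cong (members ∘ indicator)
              (ascendingPrefix-++ (members-increasing b) (nonMembers-increasing b) d) ⟩
    members (indicator (members b))
      ≡⟨ members-indicator (members-increasing b) ⟩
    members b ∎)
    where open ≡-Reasoning

  membersFirstWord-ascendingSet : ∀ π → IsPerm π → descents π ≡ 1 →
                                  membersFirstWord (ascendingSet π) ≡ π
  membersFirstWord-ascendingSet π uπ d = trans (sym (cast-is-id refl _)) (toList-injective refl _ _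
    (trans (toList-membersFirstWord (ascendingSet π))
           (membersFirst-indicator (toList π) uπ (IsPerm⇒∈ uπ) d)))

  eulerian1≡oneDescentSubsets : eulerian1 n ≡ oneDescentSubsets n
  eulerian1≡oneDescentSubsets = count-bijection _ _ (words n n) (subsets n) ascendingSet membersFirstWord
    (λ {π} (uπ , d) → trans (cong descentsList (sym (toList-membersFirstWord (ascendingSet π))))
                            (trans (cong descents (membersFirstWord-ascendingSet π uπ d)) d))
    (λ {b} d → membersFirstWord-IsPerm b , trans (cong descentsList (toList-membersFirstWord b)) d)
    (λ {π} (uπ , d) → membersFirstWord-ascendingSet π uπ d)
    (λ {b} d → ascendingSet-membersFirstWord b d)

module _ {A : Set} {n m : ℕ} (pos : Fin m → Fin n) (val : Fin m → A) where

  private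
    update : Vec A n → Fin m → Vec A n
    update δ j = δ [ pos j ]≔ val j

  lookup-foldl-update-untouched : ∀ js δ {p} → (∀ {j} → j ∈ js → pos j ≢ p) →
                                  lookup (foldl update δ js) p ≡ lookup δ p
  lookup-foldl-update-untouched []       δ _         = refl
  lookup-foldl-update-untouched (j ∷ js) δ untouched =
    trans (lookup-foldl-update-untouched js (update δ j) (untouched ∘ there))
          (lookup∘update′ (untouched (here refl) ∘ sym) δ (val j))

  lookup-foldl-update-touched : (∀ {a b} → pos a ≡ pos b → a ≡ b) →
    ∀ {js} δ {j} → Unique js → j ∈ js → lookup (foldl update δ js) (pos j) ≡ val j
  lookup-foldl-update-touched pos-inj {j ∷ js} δ (j∉js ∷ _) (here refl) =
    trans (lookup-foldl-update-untouched js (update δ j)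
            (λ j′∈js pos≡ → All.lookup j∉js j′∈js (sym (pos-inj pos≡))))
          (lookup∘update (pos j) δ (val j))
  lookup-foldl-update-touched pos-inj {j′ ∷ _} δ (_ ∷ u) (there j∈js) =
    lookup-foldl-update-touched pos-inj (update δ j′) u j∈js

module _ {n k : ℕ} (S : Strategy n) (le : suc k ≤ n) (I : Vec (Fin n) (suc k))
         (I-inj : ∀ {a b} → lookup I a ≡ lookup I b → a ≡ b) (γ : Word n) where

  private
    σ = S k le
    σ-inj : ∀ {a b} → σ ⟨$⟩ʳ a ≡ σ ⟨$⟩ʳ b → a ≡ b
    σ-inj eq = trans (sym (inverseˡ σ)) (trans (cong (σ ⟨$⟩ˡ_) eq) (inverseˡ σ))

  lookup-rearrange-outside : ∀ {p} → (∀ m → lookup I m ≢ p) →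
                             lookup (rearrange S I le γ) p ≡ lookup γ p
  lookup-rearrange-outside outside =
    lookup-foldl-update-untouched _ _ (allFin (suc k)) γ (λ {j} _ → outside (σ ⟨$⟩ʳ j))

  lookup-rearrange-inside : ∀ m →
                            lookup (rearrange S I le γ) (lookup I (σ ⟨$⟩ʳ m)) ≡ lookup γ (lookup I m)
  lookup-rearrange-inside m =
    lookup-foldl-update-touched _ _ (σ-inj ∘ I-inj) γ (Unique.allFin⁺ (suc k)) (∈-allFin m)

  position-view : ∀ p → (∃ λ m → lookup I (σ ⟨$⟩ʳ m) ≡ p) ⊎ (∀ m → lookup I m ≢ p)
  position-view p with any? (λ m → lookup I m ≟ᶠ p)
  ... | yes (m , Im≡p) = inj₁ (σ ⟨$⟩ˡ m , trans (cong (lookup I) (inverseʳ σ)) Im≡p)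
  ... | no  ∄m         = inj₂ (λ m Im≡p → ∄m (m , Im≡p))

  rearrange-injective : (∀ {p q} → lookup γ p ≡ lookup γ q → p ≡ q) →
                        ∀ {p q} → lookup (rearrange S I le γ) p ≡ lookup (rearrange S I le γ) q → p ≡ q
  rearrange-injective γ-inj {p} {q} eq with position-view p | position-view q
  ... | inj₁ (m , refl) | inj₁ (m′ , refl) = cong (λ i → lookup I (σ ⟨$⟩ʳ i))
    (I-inj (γ-inj (trans (sym (lookup-rearrange-inside m)) (trans eq (lookup-rearrange-inside m′)))))
  ... | inj₁ (m , refl) | inj₂ q-out = ⊥-elim (q-out m
    (γ-inj (trans (sym (lookup-rearrange-inside m)) (trans eq (lookup-rearrange-outside q-out)))))
  ... | inj₂ p-out      | inj₁ (m′ , refl) = ⊥-elim (p-out m′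
    (γ-inj (trans (sym (lookup-rearrange-inside m′)) (trans (sym eq) (lookup-rearrange-outside p-out)))))
  ... | inj₂ p-out      | inj₂ q-out =
    γ-inj (trans (sym (lookup-rearrange-outside p-out)) (trans eq (lookup-rearrange-outside q-out)))

-- The first two guesses

module _ {n : ℕ} where

  private
    ι = firstGuess n

  mismatches : Word n → Word n → Subset n
  mismatches γ π = tabulate (λ i → isYes (¬? (lookup γ i ≟ᶠ lookup π i)))

  members-mismatches : ∀ γ π → members (mismatches γ π) ≡ incorrect π γ
  members-mismatches γ π = members-tabulate (λ i → ¬? (lookup γ i ≟ᶠ lookup π i))

  firstGuess-injective : ∀ {i j} → lookup ι i ≡ lookup ι j → i ≡ j
  firstGuess-injective {i} {j} eq = trans (sym (lookup-allFin i)) (trans eq (lookup-allFin j))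

  rearrange-fromList-cong : (S : Strategy n) {xs ys : List (Fin n)} → xs ≡ ys →
    (le : length xs ≤ n) (le′ : length ys ≤ n) (γ : Word n) →
    rearrange S (fromList xs) le γ ≡ rearrange S (fromList ys) le′ γ
  rearrange-fromList-cong S {xs} refl le le′ γ =
    cong (λ le → rearrange S (fromList xs) le γ) (≤-irrelevant le le′)

  fixesAll⇒firstGuess : ∀ {π : Word n} → (∀ i → lookup π i ≡ i) → ι ≡ π
  fixesAll⇒firstGuess fixes = Pointwise-≡⇒≡ (ext λ i → trans (lookup-allFin i) (sym (fixes i)))

  injective-fixesAllBut⇒fixes : ∀ {π : Word n} → (∀ {i j} → lookup π i ≡ lookup π j → i ≡ j) →
                                ∀ i → (∀ j → j ≢ i → lookup π j ≡ j) → lookup π i ≡ i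
  injective-fixesAllBut⇒fixes {π} π-inj i fixes with lookup π i ≟ᶠ i
  ... | yes πi≡i = πi≡i
  ... | no  πi≢i = ⊥-elim (πi≢i (π-inj (fixes (lookup π i) πi≢i)))

  correct-firstGuess : ∀ {π : Word n} {i} → i ∉ incorrect π ι → lookup π i ≡ i
  correct-firstGuess {π} {i} i∉ with lookup ι i ≟ᶠ lookup π i
  ... | yes ιi≡πi = trans (sym ιi≡πi) (lookup-allFin i)
  ... | no  ιi≢πi =
    ⊥-elim (i∉ (∈-filter⁺ (λ j → ¬? (lookup ι j ≟ᶠ lookup π j)) (∈-allFin i) ιi≢πi))

  two≤incorrect-firstGuess : ∀ {π : Word n} → IsPerm π → ι ≢ π → 2 ≤ length (incorrect π ι)
  two≤incorrect-firstGuess {π} uπ ι≢π with incorrect π ι in eq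
  ... | []        =
    ⊥-elim (ι≢π (fixesAll⇒firstGuess (λ i → correct-firstGuess {π} (subst (i ∉_) (sym eq) λ ()))))
  ... | i ∷ []    = ⊥-elim (ι≢π (fixesAll⇒firstGuess fixesAll))
    where
    fixesAllBut-i : ∀ j → j ≢ i → lookup π j ≡ j
    fixesAllBut-i j j≢i = correct-firstGuess {π} (subst (j ∉_) (sym eq) λ { (here j≡i) → j≢i j≡i })
    fixesAll : ∀ j → lookup π j ≡ j
    fixesAll j with j ≟ᶠ i
    ... | yes refl = injective-fixesAllBut⇒fixes {π} (Unique-toList⇒lookup-injective uπ) j fixesAllBut-i
    ... | no  j≢i  = fixesAllBut-i j j≢i
  ... | _ ∷ _ ∷ _ = s≤s (s≤s z≤n)

module _ {n : ℕ} (S : Strategy n)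
         (derangements : (k : ℕ) (le : suc k ≤ n) → 2 ≤ suc k → IsDerangement (S k le)) where

  private
    ι = firstGuess n

  rearrange-firstGuess-fixes : ∀ {k} (I : Vec (Fin n) k) (le : k ≤ n) →
    (∀ {a b} → lookup I a ≡ lookup I b → a ≡ b) →
    ∀ {p} → (∀ m → lookup I m ≢ p) → lookup (rearrange S I le ι) p ≡ p
  rearrange-firstGuess-fixes {zero}  I le _     _   = lookup-allFin _
  rearrange-firstGuess-fixes {suc k} I le I-inj out =
    trans (lookup-rearrange-outside S le I I-inj ι out) (lookup-allFin _)

  rearrange-firstGuess-moves : ∀ {k} (I : Vec (Fin n) k) (le : k ≤ n) → 2 ≤ k →
    (∀ {a b} → lookup I a ≡ lookup I b → a ≡ b) →
    ∀ m → lookup (rearrange S I le ι) (lookup I m) ≢ lookup I m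
  rearrange-firstGuess-moves {suc k} I le two I-inj m fixed =
    derangements k le two m′ (trans (inverseʳ σ) (sym (I-inj Im′≡Im)))
    where
    σ = S k le
    m′ = σ ⟨$⟩ˡ m
    w = rearrange S I le ι
    Im′≡Im : lookup I m′ ≡ lookup I m
    Im′≡Im = begin
      lookup I m′                       ≡⟨ lookup-allFin _ ⟨
      lookup ι (lookup I m′)            ≡⟨ lookup-rearrange-inside S le I I-inj ι m′ ⟨
      lookup w (lookup I (σ ⟨$⟩ʳ m′))   ≡⟨ cong (λ i → lookup w (lookup I i)) (inverseʳ σ) ⟩
      lookup w (lookup I m)             ≡⟨ fixed ⟩
      lookup I m                        ∎
      where open ≡-Reasoning

  rearrange-firstGuess-injective : ∀ {k} (I : Vec (Fin n) k) (le : k ≤ n) →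
    (∀ {a b} → lookup I a ≡ lookup I b → a ≡ b) →
    ∀ {p q} → lookup (rearrange S I le ι) p ≡ lookup (rearrange S I le ι) q → p ≡ q
  rearrange-firstGuess-injective {zero}  I le _     = firstGuess-injective
  rearrange-firstGuess-injective {suc k} I le I-inj =
    rearrange-injective S le I I-inj ι firstGuess-injective

  length-members≤ : ∀ (b : Subset n) → length (members b) ≤ n
  length-members≤ b = ≤-trans (m≤m+n _ _) (≤-reflexive (length-members+nonMembers b))

  secondGuess : Subset n → Word n
  secondGuess b = rearrange S (fromList (members b)) (length-members≤ b) ι

  module _ (b : Subset n) (two : 2 ≤ length (members b)) where

    private
      I : Vec (Fin n) (length (members b))
      I = fromList (members b)
      I-inj : ∀ {a c} → lookup I a ≡ lookup I c → a ≡ c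
      I-inj = Unique⇒lookup-fromList-injective (Unique.filter⁺ (inside? b) (Unique.allFin⁺ n))

    incorrect-secondGuess : incorrect (secondGuess b) ι ≡ members b
    incorrect-secondGuess = filter-≐ _ (inside? b) (incorrect⇒member , member⇒incorrect) (allFin n)
      where
      member⇒incorrect : ∀ {i} → T (lookup b i) → lookup ι i ≢ lookup (secondGuess b) i
      member⇒incorrect {i} t ιi≡wi with ∈-fromList⇒lookup (∈-members⁺ b t)
      ... | m , refl = rearrange-firstGuess-moves I (length-members≤ b) two I-inj m
                         (trans (sym ιi≡wi) (lookup-allFin _))
      incorrect⇒member : ∀ {i} → lookup ι i ≢ lookup (secondGuess b) i → T (lookup b i)
      incorrect⇒member {i} ιi≢wi with inside? b i
      ... | yes t   = t
      ... | no  ¬t  = ⊥-elim (ιi≢wi (trans (lookup-allFin i) (sym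
                        (rearrange-firstGuess-fixes I (length-members≤ b) I-inj outside))))
        where
        outside : ∀ m → lookup I m ≢ i
        outside m Im≡i = ¬t (∈-members⁻ b (subst (_∈ members b) Im≡i (lookup-fromList-∈ (members b) m)))

    secondGuess-IsPerm : IsPerm (secondGuess b)
    secondGuess-IsPerm = lookup-injective⇒Unique-toList (secondGuess b)
      (rearrange-firstGuess-injective I (length-members≤ b) I-inj)

    firstGuess≢secondGuess : ι ≢ secondGuess b
    firstGuess≢secondGuess ι≡w with nonempty-member {xs = members b} (≤-trans (s≤s z≤n) two)
    ... | x , x∈ with ∈-fromList⇒lookup x∈
    ...   | m , refl = rearrange-firstGuess-moves I (length-members≤ b) two I-inj m
                         (trans (cong (λ v → lookup v (lookup I m)) (sym ι≡w)) (lookup-allFin _))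

    secondGuess-EndsAfter2 : EndsAfter S 2 (secondGuess b)
    secondGuess-EndsAfter2 =
      s≤s z≤n , rearrange-fromList-cong S incorrect-secondGuess _ _ ι
              , λ { zero → firstGuess≢secondGuess }

    mismatches-secondGuess : mismatches ι (secondGuess b) ≡ b
    mismatches-secondGuess =
      members-injective (trans (members-mismatches ι (secondGuess b)) incorrect-secondGuess)

  coeff-two : coeff S 2 ≡ atLeast 2 n
  coeff-two = count-bijection _ _ (words n n) (subsets n) (mismatches ι) secondGuess
    (λ {π} (uπ , _ , _ , firstGuess≢π) → ≤-trans (two≤incorrect-firstGuess uπ (firstGuess≢π zero))
                                                 (≤-reflexive (sym (cong length (members-mismatches ι π)))))
    (λ {b} two → secondGuess-IsPerm b two , secondGuess-EndsAfter2 b two)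
    (λ {π} (_ , _ , guess₂≡π , _) →
       trans (rearrange-fromList-cong S (members-mismatches ι π) _ _ ι) guess₂≡π)
    (λ {b} two → mismatches-secondGuess b two)

coeff-one : ∀ {n} (S : Strategy n) → coeff S 1 ≡ 1
coeff-one {n} S = count-bijection _ (λ _ → yes tt) (words n n) units _ (λ _ → firstGuess n)
  (λ _ → tt)
  (λ _ → lookup-injective⇒Unique-toList (firstGuess n) firstGuess-injective , s≤s z≤n , refl , λ ())
  (λ (_ , _ , firstGuess≡π , _) → firstGuess≡π)
  (λ _ → refl)

theorem4p1 : (n : ℕ) → 1 ≤ n → (S : Strategy n)
    → ((k : ℕ) (le : suc k ≤ n) → 2 ≤ suc k → IsDerangement (S k le))
    → (coeff S 1 ≡ 1)
      × (coeff S 2 ≡ eulerian1 n) × (eulerian1 n ≡ 2 ^ n ∸ n ∸ 1)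
theorem4p1 n _ S derangements =
  coeff-one S ,
  trans (coeff-two S derangements) (sym eulerian1≡atLeast-two) ,
  trans eulerian1≡atLeast-two (atLeast-two-∸ n)
  where
  eulerian1≡atLeast-two : eulerian1 n ≡ atLeast 2 n
  eulerian1≡atLeast-two = trans (eulerian1≡oneDescentSubsets n) (oneDescentSubsets≡atLeast-two n)
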